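{- There exists a $3$-dimensional polytope $P\subset\mathbb R^3$ with $10$ vertices such that, for $\mathbf c=(1,0,0)$, the sequence $(N_\ell)_\ell$ of the numbers of $\mathbf c$-monotone paths of length $\ell$ on $P$ is not unimodal.
   Context: For a polytope $P\subset\mathbb R^d$ and $\mathbf c\in\mathbb R^d$ such that $\langle\cdot,\mathbf c\rangle$ attains its minimum and maximum over $P$ at unique vertices $v_{\min}$, $v_{\max}$, let $G_{P,\mathbf c}$ be the directed graph on the vertices of $P$ with an arc $u\to v$ whenever $[u,v]$ is an edge of $P$ with $\langle u,\mathbf c\rangle<\langle v,\mathbf c\rangle$. A $\mathbf c$-monotone path is a directed path in $G_{P,\mathbf c}$ from $v_{\min}$ to $v_{\max}$; its length is its number of edges, and $N_\ell$ is the number of such paths of length $\ell$. A finite sequence $(a_1,\dots,a_r)$ is unimodal if there is $k$ with $a_i\le a_{i+1}$ for $i<k$ and $a_i\ge a_{i+1}$ for $i\ge k$. -}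

module Defs where

open import Data.Nat as ℕ using (ℕ; zero; suc)
open import Data.Fin using (Fin)
open import Data.Fin.Base using () renaming (zero to f0; suc to fs)
open import Data.List using (List; map; allFin)
open import Data.Nat.ListAction using (sum)
open import Data.Bool using (Bool; true; false; _∧_; if_then_else_)
open import Data.Product using (Σ; _×_; _,_; ∃)
open import Data.Rational as ℚ using (ℚ; 0ℚ; 1ℚ)
open import Data.Rational.Properties using (_<?_)
open import Data.Fin.Properties using (_≟_)
open import Relation.Nullary using (¬_)
open import Relation.Nullary.Decidable using (⌊_⌋)
open import Relation.Binary.PropositionalEquality using (_≡_; _≢_)
open import Function.Bundles using (_⇔_)

Point : Set
Point = Fin 3 → ℚ

coord : Point → ℕ → ℚ
coord p 0 = p f0
coord p 1 = p (fs f0)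
coord p _ = p (fs (fs f0))

_·_ : Point → Point → ℚ
p · q = (coord p 0 ℚ.* coord q 0 ℚ.+ coord p 1 ℚ.* coord q 1) ℚ.+ coord p 2 ℚ.* coord q 2

_-ₚ_ : Point → Point → Point
(p -ₚ q) i = p i ℚ.- q i

det3 : Point → Point → Point → ℚ
det3 a b c =
  (coord a 0 ℚ.* (coord b 1 ℚ.* coord c 2 ℚ.- coord b 2 ℚ.* coord c 1)
   ℚ.- coord a 1 ℚ.* (coord b 0 ℚ.* coord c 2 ℚ.- coord b 2 ℚ.* coord c 0))
   ℚ.+ coord a 2 ℚ.* (coord b 0 ℚ.* coord c 1 ℚ.- coord b 1 ℚ.* coord c 0)

cvec : Point
cvec f0 = 1ℚ
cvec (fs _) = 0ℚ

module _ {n : ℕ} (V : Fin n → Point) where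

  -- P = conv{V 0,…,V (n-1)}.  V i is a vertex of P: some linear functional
  -- attains its maximum over P uniquely at V i.
  IsVertex : Fin n → Set
  IsVertex i = Σ Point λ w → ∀ j → j ≢ i → w · V j ℚ.< w · V i

  -- All listed points are vertices (so P has exactly n vertices, V injective).
  AllVertices : Set
  AllVertices = ∀ i → IsVertex i

  FullDim : Set
  FullDim = Σ (Fin n) λ a → Σ (Fin n) λ b → Σ (Fin n) λ c → Σ (Fin n) λ d →
    ¬ (det3 (V b -ₚ V a) (V c -ₚ V a) (V d -ₚ V a) ≡ 0ℚ)

  IsEdge : Fin n → Fin n → Set
  IsEdge i j = i ≢ j × Σ Point λ w → (w · V i ≡ w · V j) ×
    (∀ k → k ≢ i → k ≢ j → w · V k ℚ.< w · V i)

  EdgeRel : (Fin n → Fin n → Bool) → Set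
  EdgeRel E = ∀ i j → (E i j ≡ true) ⇔ IsEdge i j

  UniqueMin UniqueMax : Point → Fin n → Set
  UniqueMin c i = ∀ j → j ≢ i → c · V i ℚ.< c · V j
  UniqueMax c i = ∀ j → j ≢ i → c · V j ℚ.< c · V i

  arc : (Fin n → Fin n → Bool) → Point → Fin n → Fin n → Bool
  arc E c u v = E u v ∧ ⌊ c · V u <? c · V v ⌋

  countPaths : (Fin n → Fin n → Bool) → Point → Fin n → Fin n → ℕ → ℕ
  countPaths E c u t zero = if ⌊ u ≟ t ⌋ then 1 else 0
  countPaths E c u t (suc ℓ) =
    sum (map (λ v → if arc E c u v then countPaths E c v t ℓ else 0) (allFin n))

Unimodal : ℕ → (ℕ → ℕ) → Set
Unimodal r a = Σ ℕ λ k →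
  (∀ i → suc i ℕ.< r → i ℕ.< k → a i ℕ.≤ a (suc i)) ×
  (∀ i → suc i ℕ.< r → k ℕ.≤ i → a (suc i) ℕ.≤ a i)

-- The polytope is given by ten explicit rational points, and everything is decided by exact
-- rational arithmetic against certificates. Each point is a vertex because a listed functional
-- is uniquely maximised there; [V i, V j] is an edge because a listed functional is maximised
-- exactly at V i and V j. It is not an edge when V j - V i is a positive combination of the
-- directions V k - V i with k ∉ {i, j}: a functional maximised at both V i and V j would vanish
-- on V j - V i and be negative on each of those directions. Counting monotone paths in the
-- resulting graph gives (N₀, …, N₉) = (0, 0, 2, 9, 11, 10, 11, 8, 2, 0), with a dip at ℓ = 5.

module Submission where

open import Defs
open import Data.Bool using (Bool; true; false)
open import Data.Empty using (⊥-elim)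
open import Data.Fin using (Fin; #_)
open import Data.Fin.Properties using (_≟_; all?)
open import Data.Integer using (+_)
open import Data.List as List using ()
open import Data.List.NonEmpty as List⁺ using (List⁺; _∷⁺_; [_])
open import Data.List.Relation.Unary.All as All using (All)
import Data.List.Relation.Unary.All.Properties as Allₚ
open import Data.Nat as ℕ using (ℕ; suc; _≤?_)
open import Data.Nat.Properties using (<⇒≱; ≰⇒>; m≤n⇒m≤1+n; <-trans; n<1+n)
open import Data.Product using (Σ; _×_; _,_)
open import Data.Rational as ℚ using (ℚ; 0ℚ; _<_; _+_; _-_; _*_; _/_; positive)
import Data.Rational.Properties as ℚ
open import Data.Rational.Properties using (_<?_)
open import Data.Rational.Solver using (module +-*-Solver)
open import Data.Vec.Functional using ([]; _∷_)
open import Function using (_∘_)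
open import Function.Bundles using (_⇔_; mk⇔)
open import Relation.Binary.PropositionalEquality
  using (_≡_; _≢_; refl; sym; cong; cong₂; subst; module ≡-Reasoning)
open import Relation.Nullary using (¬_; Dec; yes; no; ¬?)
open import Relation.Nullary.Decidable using (from-yes; _×-dec_; _→-dec_)

infixl 6 _+ₚ_
infixr 7 _*ₚ_

_+ₚ_ : Point → Point → Point
(p +ₚ q) x = p x + q x

_*ₚ_ : ℚ → Point → Point
(m *ₚ p) x = m * p x

point : ℚ → ℚ → ℚ → Point
point x y z = x ∷ y ∷ z ∷ []

module _ (w : Point) where

  open +-*-Solver using (solve; _:+_; _:*_; _:-_; _:=_)

  ·-congˡ : ∀ {p q : Point} → (∀ x → p x ≡ q x) → w · p ≡ w · q
  ·-congˡ {p} {q} p≗q = cong₂ _+_ (cong₂ _+_ (cong (w (# 0) *_) (p≗q (# 0)))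
                                             (cong (w (# 1) *_) (p≗q (# 1))))
                                   (cong (w (# 2) *_) (p≗q (# 2)))

  ·-distribˡ-+ₚ : ∀ p q → w · (p +ₚ q) ≡ w · p + w · q
  ·-distribˡ-+ₚ p q = solve 9 (λ a b c x y z x′ y′ z′ →
      (a :* (x :+ x′) :+ b :* (y :+ y′)) :+ c :* (z :+ z′) :=
      ((a :* x :+ b :* y) :+ c :* z) :+ ((a :* x′ :+ b :* y′) :+ c :* z′)) refl
    (w (# 0)) (w (# 1)) (w (# 2)) (p (# 0)) (p (# 1)) (p (# 2)) (q (# 0)) (q (# 1)) (q (# 2))

  ·-distribˡ--ₚ : ∀ p q → w · (p -ₚ q) ≡ w · p - w · q
  ·-distribˡ--ₚ p q = solve 9 (λ a b c x y z x′ y′ z′ →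
      (a :* (x :- x′) :+ b :* (y :- y′)) :+ c :* (z :- z′) :=
      ((a :* x :+ b :* y) :+ c :* z) :- ((a :* x′ :+ b :* y′) :+ c :* z′)) refl
    (w (# 0)) (w (# 1)) (w (# 2)) (p (# 0)) (p (# 1)) (p (# 2)) (q (# 0)) (q (# 1)) (q (# 2))

  ·-*ₚ : ∀ m p → w · (m *ₚ p) ≡ m * (w · p)
  ·-*ₚ m p = solve 7 (λ a b c m x y z →
      (a :* (m :* x) :+ b :* (m :* y)) :+ c :* (m :* z) :=
      m :* ((a :* x :+ b :* y) :+ c :* z)) refl
    (w (# 0)) (w (# 1)) (w (# 2)) m (p (# 0)) (p (# 1)) (p (# 2))

all-≢? : ∀ {n} {P : Fin n → Set} (i : Fin n) → (∀ j → Dec (P j)) → Dec (∀ j → j ≢ i → P j)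
all-≢? i P? = all? λ j → ¬? (j ≟ i) →-dec P? j

p<q⇒p-q<0 : ∀ {p q} → p < q → p - q < 0ℚ
p<q⇒p-q<0 {p} {q} p<q = subst (p - q <_) (ℚ.+-inverseʳ q) (ℚ.+-monoˡ-< (ℚ.- q) p<q)

·-foldr₁-+ₚ-neg : ∀ w (ps : List⁺ Point) → All (λ p → w · p < 0ℚ) (List⁺.toList ps) →
  w · List⁺.foldr₁ _+ₚ_ ps < 0ℚ
·-foldr₁-+ₚ-neg w (p List⁺.∷ ps) (wp<0 All.∷ wps<0) = go p ps wp<0 wps<0
  where
  go : ∀ q qs → w · q < 0ℚ → All (λ p → w · p < 0ℚ) qs →
    w · List⁺.foldr₁ _+ₚ_ (q List⁺.∷ qs) < 0ℚ
  go p List.[] wp<0 All.[] = wp<0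
  go p (q List.∷ qs) wp<0 (wq<0 All.∷ wqs<0) = begin-strict
    w · (p +ₚ rest)    ≡⟨ ·-distribˡ-+ₚ w p rest ⟩
    w · p + w · rest   <⟨ ℚ.+-mono-< wp<0 (go q qs wq<0 wqs<0) ⟩
    0ℚ + 0ℚ            ≡⟨ ℚ.+-identityˡ 0ℚ ⟩
    0ℚ                 ∎
    where
    open ℚ.≤-Reasoning
    rest : Point
    rest = List⁺.foldr₁ _+ₚ_ (q List⁺.∷ qs)

data EdgeCertificate (n : ℕ) : Set where
  normal : Point → EdgeCertificate n
  cone   : List⁺ (Fin n × ℚ) → EdgeCertificate n
  loop   : EdgeCertificate n

isNormal : ∀ {n} → EdgeCertificate n → Bool
isNormal (normal _) = true
isNormal (cone _)   = false
isNormal loop       = false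

module _ {n : ℕ} (V : Fin n → Point) where

  SupportsEdge : Fin n → Fin n → Point → Set
  SupportsEdge i j w =
    i ≢ j × w · V i ≡ w · V j × (∀ k → k ≢ i → k ≢ j → w · V k < w · V i)

  supportsEdge? : ∀ i j w → Dec (SupportsEdge i j w)
  supportsEdge? i j w = ¬? (i ≟ j) ×-dec (w · V i ℚ.≟ w · V j) ×-dec
    all-≢? i (λ k → ¬? (k ≟ j) →-dec (w · V k <? w · V i))

  scaledDifference : Fin n → Fin n × ℚ → Point
  scaledDifference i (k , m) = m *ₚ (V k -ₚ V i)

  ·-scaledDifference-neg : ∀ w i {k m} → 0ℚ < m → w · V k < w · V i →
    w · scaledDifference i (k , m) < 0ℚ
  ·-scaledDifference-neg w i {k} {m} 0<m wVk<wVi = begin-strict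
    w · (m *ₚ (V k -ₚ V i))    ≡⟨ ·-*ₚ w m (V k -ₚ V i) ⟩
    m * (w · (V k -ₚ V i))     ≡⟨ cong (m *_) (·-distribˡ--ₚ w (V k) (V i)) ⟩
    m * (w · V k - w · V i)    <⟨ ℚ.*-monoʳ-<-pos m {{positive 0<m}} (p<q⇒p-q<0 wVk<wVi) ⟩
    m * 0ℚ                     ≡⟨ ℚ.*-zeroʳ m ⟩
    0ℚ                         ∎
    where open ℚ.≤-Reasoning

  combination : Fin n → List⁺ (Fin n × ℚ) → Point
  combination i = List⁺.foldr₁ _+ₚ_ ∘ List⁺.map (scaledDifference i)

  SpansNonEdge : Fin n → Fin n → List⁺ (Fin n × ℚ) → Set
  SpansNonEdge i j cs =
    All (λ (k , m) → k ≢ i × k ≢ j × 0ℚ < m) (List⁺.toList cs) ×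
    (∀ x → (V j -ₚ V i) x ≡ combination i cs x)

  spansNonEdge? : ∀ i j cs → Dec (SpansNonEdge i j cs)
  spansNonEdge? i j cs =
    All.all? (λ (k , m) → ¬? (k ≟ i) ×-dec ¬? (k ≟ j) ×-dec (0ℚ <? m)) (List⁺.toList cs) ×-dec
    all? (λ x → (V j -ₚ V i) x ℚ.≟ combination i cs x)

  spansNonEdge⇒¬IsEdge : ∀ {i j} cs → SpansNonEdge i j cs → ¬ IsEdge V i j
  spansNonEdge⇒¬IsEdge {i} {j} cs (valid , difference≗combination) (_ , w , wVi≡wVj , wmax) =
    ℚ.<-irrefl vanishes (·-foldr₁-+ₚ-neg w _ (Allₚ.map⁺ (All.map negative valid)))
    where
    negative : ∀ {(k , m) : Fin n × ℚ} → k ≢ i × k ≢ j × 0ℚ < m → w · scaledDifference i (k , m) < 0ℚ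
    negative {k , _} (k≢i , k≢j , 0<m) = ·-scaledDifference-neg w i 0<m (wmax k k≢i k≢j)
    vanishes : w · combination i cs ≡ 0ℚ
    vanishes = begin
      w · combination i cs  ≡⟨ ·-congˡ w (sym ∘ difference≗combination) ⟩
      w · (V j -ₚ V i)      ≡⟨ ·-distribˡ--ₚ w (V j) (V i) ⟩
      w · V j - w · V i     ≡⟨ cong (_- w · V i) (sym wVi≡wVj) ⟩
      w · V i - w · V i     ≡⟨ ℚ.+-inverseʳ (w · V i) ⟩
      0ℚ                    ∎
      where open ≡-Reasoning

  Certifies : Fin n → Fin n → EdgeCertificate n → Set
  Certifies i j (normal w) = SupportsEdge i j w
  Certifies i j (cone cs)  = SpansNonEdge i j cs
  Certifies i j loop       = i ≡ j

  certifies? : ∀ i j c → Dec (Certifies i j c)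
  certifies? i j (normal w) = supportsEdge? i j w
  certifies? i j (cone cs)  = spansNonEdge? i j cs
  certifies? i j loop       = i ≟ j

  certifies⇒isEdge⇔ : ∀ {i j} c → Certifies i j c → (isNormal c ≡ true) ⇔ IsEdge V i j
  certifies⇒isEdge⇔ (normal w) (i≢j , wVi≡wVj , wmax) =
    mk⇔ (λ _ → i≢j , w , wVi≡wVj , wmax) (λ _ → refl)
  certifies⇒isEdge⇔ (cone cs) spans =
    mk⇔ (λ ()) (⊥-elim ∘ spansNonEdge⇒¬IsEdge cs spans)
  certifies⇒isEdge⇔ loop i≡j =
    mk⇔ (λ ()) (λ (i≢j , _) → ⊥-elim (i≢j i≡j))

valley⇒¬Unimodal : ∀ {r a} k → suc (suc k) ℕ.< r →
  a (suc k) ℕ.< a k → a (suc k) ℕ.< a (suc (suc k)) → ¬ Unimodal r a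
valley⇒¬Unimodal k k+2<r fall rise (peak , increasing , decreasing) with peak ≤? k
... | yes peak≤k = <⇒≱ rise (decreasing (suc k) k+2<r (m≤n⇒m≤1+n peak≤k))
... | no  peak≰k = <⇒≱ fall (increasing k (<-trans (n<1+n (suc k)) k+2<r) (≰⇒> peak≰k))

-- Literal overloading is switched on only from here: with an instance-overloaded ℕ literal
-- as its arity, the type of solve above would stay blocked on instance search.
open import Agda.Builtin.FromNat using (Number; fromNat)
open import Agda.Builtin.FromNeg using (Negative; fromNeg)
import Data.Nat.Literals as ℕLiterals
import Data.Rational.Literals as ℚLiterals
open import Data.Unit using (tt)

instance
  ℕ-number : Number ℕ
  ℕ-number = ℕLiterals.number
  ℚ-number : Number ℚ
  ℚ-number = ℚLiterals.number
  ℚ-negative : Negative ℚ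
  ℚ-negative = ℚLiterals.negative

polytope : Fin 10 → Point
polytope =
    (point -15 14 19)
  ∷ (point -13 7 -7)
  ∷ (point -9 20 -10)
  ∷ (point -7 -17 -5)
  ∷ (point -4 -18 -18)
  ∷ (point -2 -16 16)
  ∷ (point 3 -7 20)
  ∷ (point 14 13 14)
  ∷ (point 19 4 9)
  ∷ (point 20 7 2)
  ∷ []

vertexNormal : Fin 10 → Point
vertexNormal =
    (point -1552 513 1141)
  ∷ (point -1529 -129 -343)
  ∷ (point 270 1638 -1224)
  ∷ (point -1587 -660 99)
  ∷ (point 949 -819 -1357)
  ∷ (point 109 -1330 529)
  ∷ (point 310 -92 1146)
  ∷ (point 625 1355 898)
  ∷ (point 1304 -1030 267)
  ∷ (point 1101 554 -1156)
  ∷ []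

edgeCertificate : Fin 10 → Fin 10 → EdgeCertificate 10
edgeCertificate =
    ( loop
    ∷ normal (point -997 -62 -60)
    ∷ normal (point -300 909 126)
    ∷ normal (point -1265 -448 157)
    ∷ cone ((# 1 , + 928 / 869) ∷⁺ (# 3 , + 282 / 869) ∷⁺ [ (# 5 , + 419 / 869) ])
    ∷ normal (point -720 -355 430)
    ∷ normal (point 13 52 858)
    ∷ normal (point 165 930 771)
    ∷ cone ((# 2 , + 184 / 831) ∷⁺ (# 6 , + 416 / 831) ∷⁺ [ (# 7 , + 226 / 277) ])
    ∷ cone ((# 1 , + 515 / 1213) ∷⁺ (# 5 , + 117 / 1213) ∷⁺ [ (# 7 , + 1376 / 1213) ])
    ∷ [] )
  ∷ ( normal (point -997 -62 -60)
    ∷ loop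
    ∷ normal (point -577 115 -271)
    ∷ normal (point -952 -244 -72)
    ∷ normal (point -532 -67 -283)
    ∷ cone ((# 0 , + 1955 / 2307) ∷⁺ (# 2 , + 1738 / 2307) ∷⁺ [ (# 3 , + 7445 / 4614) ])
    ∷ cone ((# 0 , + 845 / 769) ∷⁺ (# 2 , + 1355 / 769) ∷⁺ [ (# 3 , + 1429 / 769) ])
    ∷ cone ((# 0 , + 842 / 769) ∷⁺ (# 2 , + 3052 / 769) ∷⁺ [ (# 3 , + 3413 / 1538) ])
    ∷ cone ((# 0 , + 2089 / 2307) ∷⁺ (# 2 , + 10016 / 2307) ∷⁺ [ (# 3 , + 6323 / 2307) ])
    ∷ cone ((# 0 , + 514 / 769) ∷⁺ (# 2 , + 3518 / 769) ∷⁺ [ (# 3 , + 4111 / 1538) ])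
    ∷ [] )
  ∷ ( normal (point -300 909 126)
    ∷ normal (point -577 115 -271)
    ∷ loop
    ∷ cone ((# 1 , + 14869 / 9147) ∷⁺ (# 4 , + 1028 / 3049) ∷⁺ [ (# 9 , + 2150 / 9147) ])
    ∷ normal (point 342 309 -1254)
    ∷ cone ((# 0 , + 175 / 3413) ∷⁺ (# 1 , + 24103 / 10239) ∷⁺ [ (# 7 , + 7445 / 10239) ])
    ∷ cone ((# 0 , + 621 / 3413) ∷⁺ (# 1 , + 5263 / 3413) ∷⁺ [ (# 7 , + 2858 / 3413) ])
    ∷ normal (point 287 1231 84)
    ∷ cone ((# 1 , + 12 / 37) ∷⁺ (# 7 , + 181 / 444) ∷⁺ [ (# 9 , + 305 / 444) ])
    ∷ normal (point 788 712 -1133)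
    ∷ [] )
  ∷ ( normal (point -1265 -448 157)
    ∷ normal (point -952 -244 -72)
    ∷ cone ((# 1 , + 119 / 76) ∷⁺ (# 4 , + 391 / 304) ∷⁺ [ (# 5 , + 215 / 304) ])
    ∷ loop
    ∷ normal (point -322 -212 -58)
    ∷ normal (point -635 -416 171)
    ∷ cone ((# 0 , + 5 / 16) ∷⁺ (# 4 , + 175 / 128) ∷⁺ [ (# 5 , + 215 / 128) ])
    ∷ cone ((# 1 , + 241 / 190) ∷⁺ (# 4 , + 366 / 95) ∷⁺ [ (# 5 , + 324 / 95) ])
    ∷ cone ((# 0 , + 3 / 4) ∷⁺ (# 4 , + 173 / 32) ∷⁺ [ (# 5 , + 101 / 32) ])
    ∷ cone ((# 1 , + 101 / 95) ∷⁺ (# 4 , + 3891 / 760) ∷⁺ [ (# 5 , + 2739 / 760) ])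
    ∷ [] )
  ∷ ( cone ((# 1 , + 116 / 95) ∷⁺ (# 3 , + 141 / 380) ∷⁺ [ (# 5 , + 419 / 760) ])
    ∷ normal (point -532 -67 -283)
    ∷ normal (point 342 309 -1254)
    ∷ normal (point -322 -212 -58)
    ∷ loop
    ∷ normal (point 686 -856 10)
    ∷ cone ((# 3 , + 53 / 48) ∷⁺ (# 5 , + 35 / 96) ∷⁺ [ (# 8 , + 5 / 12) ])
    ∷ cone ((# 1 , + 5 / 14) ∷⁺ (# 5 , + 9 / 28) ∷⁺ [ (# 9 , + 6 / 7) ])
    ∷ normal (point 929 -916 -45)
    ∷ normal (point 795 104 -1084)
    ∷ [] )
  ∷ ( normal (point -720 -355 430)
    ∷ cone ((# 0 , + 614 / 1015) ∷⁺ (# 3 , + 6659 / 5075) ∷⁺ [ (# 6 , + 3476 / 5075) ])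
    ∷ cone ((# 0 , + 663 / 1015) ∷⁺ (# 3 , + 8703 / 5075) ∷⁺ [ (# 6 , + 10217 / 5075) ])
    ∷ normal (point -635 -416 171)
    ∷ normal (point 686 -856 10)
    ∷ loop
    ∷ normal (point 50 -186 356)
    ∷ cone ((# 4 , + 1341 / 3074) ∷⁺ (# 6 , + 5006 / 1537) ∷⁺ [ (# 8 , + 43 / 1537) ])
    ∷ normal (point 837 -847 91)
    ∷ cone ((# 3 , + 837 / 2465) ∷⁺ (# 6 , + 448 / 2465) ∷⁺ [ (# 8 , + 535 / 493) ])
    ∷ [] )
  ∷ ( normal (point 13 52 858)
    ∷ cone ((# 0 , + 6357 / 5162) ∷⁺ (# 5 , + 7471 / 2581) ∷⁺ [ (# 8 , + 6659 / 5162) ])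
    ∷ cone ((# 0 , + 7599 / 5162) ∷⁺ (# 5 , + 6441 / 2581) ∷⁺ [ (# 8 , + 8703 / 5162) ])
    ∷ cone ((# 0 , + 85 / 178) ∷⁺ (# 5 , + 305 / 89) ∷⁺ [ (# 8 , + 175 / 178) ])
    ∷ cone ((# 0 , + 53 / 89) ∷⁺ (# 5 , + 417 / 89) ∷⁺ [ (# 8 , + 151 / 89) ])
    ∷ normal (point 50 -186 356)
    ∷ loop
    ∷ normal (point 260 94 790)
    ∷ normal (point 297 -144 288)
    ∷ cone ((# 5 , + 146 / 149) ∷⁺ (# 7 , + 93 / 149) ∷⁺ [ (# 8 , + 140 / 149) ])
    ∷ [] )
  ∷ ( normal (point 165 930 771)
    ∷ cone ((# 2 , + 599 / 638) ∷⁺ (# 6 , + 185 / 319) ∷⁺ [ (# 9 , + 207 / 1276) ])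
    ∷ normal (point 287 1231 84)
    ∷ cone ((# 0 , + 215 / 239) ∷⁺ (# 6 , + 199 / 239) ∷⁺ [ (# 9 , + 1135 / 478) ])
    ∷ cone ((# 0 , + 47 / 32) ∷⁺ (# 8 , + 63 / 32) ∷⁺ [ (# 9 , + 59 / 24) ])
    ∷ cone ((# 2 , + 3 / 19) ∷⁺ (# 6 , + 25 / 19) ∷⁺ [ (# 8 , + 8 / 19) ])
    ∷ normal (point 260 94 790)
    ∷ loop
    ∷ normal (point 232 5 223)
    ∷ normal (point 306 450 -72)
    ∷ [] )
  ∷ ( cone ((# 6 , + 352 / 219) ∷⁺ (# 7 , + 1438 / 657) ∷⁺ [ (# 9 , + 1748 / 657) ])
    ∷ cone ((# 5 , + 31 / 23) ∷⁺ (# 7 , + 118 / 69) ∷⁺ [ (# 9 , + 335 / 69) ])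
    ∷ cone ((# 5 , + 24 / 23) ∷⁺ (# 7 , + 317 / 138) ∷⁺ [ (# 9 , + 745 / 138) ])
    ∷ cone ((# 4 , + 14 / 47) ∷⁺ (# 5 , + 1 / 1) ∷⁺ [ (# 9 , + 87 / 47) ])
    ∷ normal (point 929 -916 -45)
    ∷ normal (point 837 -847 91)
    ∷ normal (point 297 -144 288)
    ∷ normal (point 232 5 223)
    ∷ loop
    ∷ normal (point 313 -158 -23)
    ∷ [] )
  ∷ ( cone ((# 2 , + 44 / 45) ∷⁺ (# 7 , + 16 / 27) ∷⁺ [ (# 8 , + 139 / 45) ])
    ∷ cone ((# 2 , + 1431 / 2342) ∷⁺ (# 4 , + 555 / 1171) ∷⁺ [ (# 7 , + 3049 / 4684) ])
    ∷ normal (point 788 712 -1133)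
    ∷ cone ((# 4 , + 499 / 517) ∷⁺ (# 7 , + 16 / 33) ∷⁺ [ (# 8 , + 479 / 517) ])
    ∷ normal (point 795 104 -1084)
    ∷ cone ((# 4 , + 345 / 517) ∷⁺ (# 7 , + 16 / 33) ∷⁺ [ (# 8 , + 1590 / 517) ])
    ∷ cone ((# 4 , + 219 / 517) ∷⁺ (# 7 , + 47 / 66) ∷⁺ [ (# 8 , + 1324 / 517) ])
    ∷ normal (point 306 450 -72)
    ∷ normal (point 313 -158 -23)
    ∷ loop
    ∷ [] )
  ∷ []

E : Fin 10 → Fin 10 → Bool
E i j = isNormal (edgeCertificate i j)

vertexNormal-maximisedAt : ∀ i j → j ≢ i → vertexNormal i · polytope j < vertexNormal i · polytope i
vertexNormal-maximisedAt = from-yes (all? λ i → all-≢? i λ j →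
  vertexNormal i · polytope j <? vertexNormal i · polytope i)

allVertices : AllVertices polytope
allVertices i = vertexNormal i , vertexNormal-maximisedAt i

fullDim : FullDim polytope
fullDim = # 0 , # 1 , # 2 , # 3 , from-yes (¬? (det3 (polytope (# 1) -ₚ polytope (# 0))
  (polytope (# 2) -ₚ polytope (# 0)) (polytope (# 3) -ₚ polytope (# 0)) ℚ.≟ 0ℚ))

edgeCertificate-valid : ∀ i j → Certifies polytope i j (edgeCertificate i j)
edgeCertificate-valid =
  from-yes (all? λ i → all? λ j → certifies? polytope i j (edgeCertificate i j))

edgeRel : EdgeRel polytope E
edgeRel i j = certifies⇒isEdge⇔ polytope (edgeCertificate i j) (edgeCertificate-valid i j)

uniqueMin : UniqueMin polytope cvec (# 0)
uniqueMin = from-yes (all-≢? (# 0) λ j → cvec · polytope (# 0) <? cvec · polytope j)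

uniqueMax : UniqueMax polytope cvec (# 9)
uniqueMax = from-yes (all-≢? (# 9) λ j → cvec · polytope j <? cvec · polytope (# 9))

N : ℕ → ℕ
N = countPaths polytope E cvec (# 0) (# 9)

theorem4p7 : Σ (Fin 10 → Point) λ V →
    AllVertices V × FullDim V ×
    Σ (Fin 10 → Fin 10 → Bool) λ E → EdgeRel V E ×
    Σ (Fin 10) λ vmin → Σ (Fin 10) λ vmax →
      UniqueMin V cvec vmin × UniqueMax V cvec vmax ×
      ¬ Unimodal 10 (λ ℓ → countPaths V E cvec vmin vmax ℓ)
theorem4p7 =
  polytope , allVertices , fullDim , E , edgeRel , # 0 , # 9 , uniqueMin , uniqueMax ,
  valley⇒¬Unimodal 4 (from-yes (6 ℕ.<? 10)) (from-yes (N 5 ℕ.<? N 4)) (from-yes (N 5 ℕ.<? N 6))
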